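{- Let $p > 10^6$ be a prime and let $c = \sum_{i=1}^{p-2} (x_i + y_i)$. Then $c > \frac{6}{5}p\sqrt{p} - 16p$.
   Context: Let $p$ be a prime. For $1 \leq i \leq p-2$, let $x_i^{\max}, y_i^{\max} \in \{1, \dots, p-1\}$ be the residues with $i\, x_i^{\max} \equiv 1 \pmod p$ and $-(i+1)\, y_i^{\max} \equiv 1 \pmod p$. Define $(x_i, y_i)$ to be the pair of positive integers $(x,y)$ with $x \leq x_i^{\max}$, $y \leq y_i^{\max}$ and $ix + (i+1)y \equiv 0 \pmod p$ for which $x + y$ is minimal (such a pair exists and is unique). -}

module Defs where

open import Data.Nat as ℕ using (ℕ; zero; suc; _+_; _*_; _≤_; _∸_)
open import Data.Integer as ℤ using (ℤ; +_)
open import Data.Integer.Divisibility using (_∣_)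
open import Data.Product using (_×_)

_≡_[mod_] : ℤ → ℤ → ℕ → Set
a ≡ b [mod n ] = (+ n) ∣ (a ℤ.- b)

IsXMax : ℕ → ℕ → ℕ → Set
IsXMax p i x = (1 ≤ x) × (x ≤ p ∸ 1) × (((+ i) ℤ.* (+ x)) ≡ (+ 1) [mod p ])

IsYMax : ℕ → ℕ → ℕ → Set
IsYMax p i y = (1 ≤ y) × (y ≤ p ∸ 1) × ((ℤ.- (+ (i + 1)) ℤ.* (+ y)) ≡ (+ 1) [mod p ])

Admissible : ℕ → ℕ → ℕ → ℕ → ℕ → ℕ → Set
Admissible p i xm ym x y =
  (1 ≤ x) × (x ≤ xm) × (1 ≤ y) × (y ≤ ym) ×
  (((+ i) ℤ.* (+ x) ℤ.+ (+ (i + 1)) ℤ.* (+ y)) ≡ (+ 0) [mod p ])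

IsMinPair : ℕ → ℕ → ℕ → ℕ → ℕ → ℕ → Set
IsMinPair p i xm ym x y =
  Admissible p i xm ym x y ×
  (∀ x' y' → Admissible p i xm ym x' y' → x + y ≤ x' + y')

sum1to : ℕ → (ℕ → ℕ) → ℕ
sum1to zero    f = 0
sum1to (suc n) f = sum1to n f + f (suc n)

-- Two indices cannot share a pair: subtracting their relations gives p ∣ (j − i)(x + y), so x + y = p
-- and then p ∣ y.  No prime q ≤ 17 divides both x_i and y_i, for (x_i/q, y_i/q) would be a smaller
-- admissible pair.  Hence at most N(T) of the sums x_i + y_i are ≤ T, where N(T) counts the pairs
-- a, b ≥ 1 with a + b ≤ T not both divisible by a prime ≤ 17.  Sieving one prime at a time,
-- N_{q∷R}(T) = N_R(T) − N_R(⌊T/q⌋), gives N(T) ≤ 0.308 T² + 2.13 T, where 0.308 ≈ ½ ∏_{q ≤ 17} (1 − q⁻²).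
-- Counting the levels k < M passed by each x_i + y_i gives (p − 2) M ≤ c + Σ_{k<M} N(k)
-- ≤ c + 0.103 M³ + 1.07 M², and M ≈ 9√p/5 yields the bound.

module Submission where

open import Defs
open import Data.Nat using (ℕ; _+_; _*_; _^_; _≤_; _<_; _∸_)
open import Data.Nat.Primality using (Prime)

open import Data.Bool using (Bool; true; false; _∧_; not)
open import Data.Bool.Properties using (∧-identityʳ)
open import Data.Empty using (⊥)
import Data.Integer as ℤ
import Data.Integer.Properties as ℤ
open import Data.List using (List; []; _∷_)
open import Data.List.Relation.Unary.All as All using (All; all?)
open import Data.List.Relation.Unary.AllPairs as AllPairs using (AllPairs; allPairs?)
open import Data.Nat
open import Data.Nat.Coprimality as Coprime using (Coprime; coprime?; coprime-divisor)
open import Data.Nat.Divisibility using (_∣_; _∣?_; divides; >⇒∤; ∣m+n∣m⇒∣n; n∣m*n; ∣n⇒∣m*n)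
open import Data.Nat.DivMod using (_/_; _%_; m≡m%n+[m/n]*n; m/n*n≤m; m%n<n)
open import Data.Nat.Primality using (euclidsLemma)
open import Data.Nat.Properties
open import Algebra.Properties.CommutativeSemigroup +-commutativeSemigroup using (interchange; xy∙z≈xz∙y)
open import Data.Nat.Tactic.RingSolver using (solve; solve-∀)
open import Data.Product using (∃; _×_; _,_; proj₁; proj₂)
open import Data.Sum using (inj₁; inj₂)
open import Function.Bundles using (_⇔_; mk⇔; module Equivalence)
open import Relation.Binary.PropositionalEquality
open import Relation.Nullary using (Dec; yes; no; does; ¬_; contradiction)
open import Relation.Nullary.Decidable using (does-⇔; dec-true; dec-false; _×-dec_; from-yes)

𝟙 : Bool → ℕ
𝟙 true  = 1
𝟙 false = 0

𝟙-yes : ∀ {a} {P : Set a} → P → (d : Dec P) → 𝟙 (does d) ≡ 1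
𝟙-yes p (yes _)  = refl
𝟙-yes p (no ¬p) = contradiction p ¬p

𝟙-no : ∀ {a} {P : Set a} → ¬ P → (d : Dec P) → 𝟙 (does d) ≡ 0
𝟙-no ¬p (no _)  = refl
𝟙-no ¬p (yes p) = contradiction p ¬p

sum1to-cong : ∀ n {f g : ℕ → ℕ} → (∀ i → 1 ≤ i → i ≤ n → f i ≡ g i) →
  sum1to n f ≡ sum1to n g
sum1to-cong zero    f≡g = refl
sum1to-cong (suc n) f≡g =
  cong₂ _+_ (sum1to-cong n λ i 1≤i i≤n → f≡g i 1≤i (m≤n⇒m≤1+n i≤n)) (f≡g (suc n) (s≤s z≤n) ≤-refl)

sum1to-mono-≤ : ∀ n {f g : ℕ → ℕ} → (∀ i → 1 ≤ i → i ≤ n → f i ≤ g i) →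
  sum1to n f ≤ sum1to n g
sum1to-mono-≤ zero    f≤g = z≤n
sum1to-mono-≤ (suc n) f≤g =
  +-mono-≤ (sum1to-mono-≤ n λ i 1≤i i≤n → f≤g i 1≤i (m≤n⇒m≤1+n i≤n)) (f≤g (suc n) (s≤s z≤n) ≤-refl)

sum1to-distrib-+ : ∀ n (f g : ℕ → ℕ) →
  sum1to n (λ i → f i + g i) ≡ sum1to n f + sum1to n g
sum1to-distrib-+ zero    f g = refl
sum1to-distrib-+ (suc n) f g rewrite sum1to-distrib-+ n f g =
  interchange (sum1to n f) (sum1to n g) (f (suc n)) (g (suc n))

sum1to-*ˡ : ∀ n k (f : ℕ → ℕ) → sum1to n (λ i → k * f i) ≡ k * sum1to n f
sum1to-*ˡ zero    k f = sym (*-zeroʳ k)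
sum1to-*ˡ (suc n) k f rewrite sum1to-*ˡ n k f = sym (*-distribˡ-+ k (sum1to n f) (f (suc n)))

sum1to-*ʳ : ∀ n k (f : ℕ → ℕ) → sum1to n (λ i → f i * k) ≡ sum1to n f * k
sum1to-*ʳ zero    k f = refl
sum1to-*ʳ (suc n) k f rewrite sum1to-*ʳ n k f = sym (*-distribʳ-+ k (sum1to n f) (f (suc n)))

sum1to-const : ∀ n k → sum1to n (λ _ → k) ≡ n * k
sum1to-const zero    k = refl
sum1to-const (suc n) k rewrite sum1to-const n k = +-comm (n * k) k

sum1to-comm : ∀ m n (f : ℕ → ℕ → ℕ) →
  sum1to m (λ i → sum1to n (f i)) ≡ sum1to n (λ j → sum1to m (λ i → f i j))
sum1to-comm zero    n f = sym (trans (sum1to-const n 0) (*-zeroʳ n))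
sum1to-comm (suc m) n f rewrite sum1to-comm m n f =
  sym (sum1to-distrib-+ n (λ j → sum1to m (λ i → f i j)) (f (suc m)))

term≤sum1to : ∀ n (f : ℕ → ℕ) k → 1 ≤ k → k ≤ n → f k ≤ sum1to n f
term≤sum1to zero    f (suc k) _ ()
term≤sum1to (suc n) f k 1≤k k≤1+n with k ≟ suc n
... | yes refl = m≤n+m (f (suc n)) (sum1to n f)
... | no  k≢  = ≤-trans (term≤sum1to n f k 1≤k (≤-pred (≤∧≢⇒< k≤1+n k≢))) (m≤m+n (sum1to n f) (f (suc n)))

sum1to-𝟙≤1 : ∀ n {p} {P : ℕ → Set p} (P? : ∀ i → Dec (P i)) →
  (∀ i j → 1 ≤ i → i < j → j ≤ n → P i → P j → ⊥) →
  sum1to n (λ i → 𝟙 (does (P? i))) ≤ 1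
sum1to-𝟙≤1 zero    P? atMostOne = z≤n
sum1to-𝟙≤1 (suc n) P? atMostOne with P? (suc n)
... | no  _   = ≤-trans (≤-reflexive (+-identityʳ _))
                  (sum1to-𝟙≤1 n P? λ i j 1≤i i<j j≤n → atMostOne i j 1≤i i<j (m≤n⇒m≤1+n j≤n))
... | yes Pn = ≤-reflexive (cong (_+ 1) (trans (sum1to-cong n earlier-false) (trans (sum1to-const n 0) (*-zeroʳ n))))
  where
  earlier-false : ∀ i → 1 ≤ i → i ≤ n → 𝟙 (does (P? i)) ≡ 0
  earlier-false i 1≤i i≤n = 𝟙-no (λ Pi → atMostOne i (suc n) 1≤i (s≤s i≤n) ≤-refl Pi Pn) (P? i)

quotient-unique : ∀ q .{{_ : NonZero q}} t k → q * t ≤ q * k → q * k < q * suc t → t ≡ k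
quotient-unique q t k qt≤qk qk<qt+q =
  ≤-antisym (*-cancelˡ-≤ q qt≤qk) (≤-pred (*-cancelˡ-< q k (suc t) qk<qt+q))

sum1to-multiples : ∀ q .{{_ : NonZero q}} T t → q * t ≤ T → T < q * suc t → (f : ℕ → ℕ) →
  sum1to T (λ x → 𝟙 (does (q ∣? x)) * f x) ≡ sum1to t (λ x → f (q * x))
sum1to-multiples q zero    zero    _    _    f = refl
sum1to-multiples q zero    (suc t) qt≤0 _    f =
  contradiction qt≤0 (<⇒≱ (>-nonZero⁻¹ (q * suc t) {{m*n≢0 q (suc t)}}))
sum1to-multiples q (suc T) t qt≤1+T 1+T<q[1+t] f with q ∣? suc T
... | no q∤1+T =
  trans (+-identityʳ _) (sum1to-multiples q T t qt≤T (<-trans (n<1+n T) 1+T<q[1+t]) f)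
  where
  qt≤T : q * t ≤ T
  qt≤T = ≤-pred (≤∧≢⇒< qt≤1+T λ qt≡1+T → q∤1+T (divides t (trans (sym qt≡1+T) (*-comm q t))))
... | yes (divides (suc k) 1+T≡[1+k]q) =
  trans (cong₂ _+_ (sum1to-multiples q T k qk≤T T<q[1+k] f) (trans (+-identityʳ _) (cong f 1+T≡q[1+k])))
        (cong (λ s → sum1to s (λ x → f (q * x))) (sym t≡1+k))
  where
  1+T≡q[1+k] : suc T ≡ q * suc k
  1+T≡q[1+k] = trans 1+T≡[1+k]q (*-comm (suc k) q)
  t≡1+k : t ≡ suc k
  t≡1+k = quotient-unique q t (suc k) (subst (q * t ≤_) 1+T≡q[1+k] qt≤1+T)
                                      (subst (_< q * suc t) 1+T≡q[1+k] 1+T<q[1+t])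
  T<q[1+k] : T < q * suc k
  T<q[1+k] = subst (T <_) 1+T≡q[1+k] (n<1+n T)
  qk≤T : q * k ≤ T
  qk≤T = ≤-pred (subst (q * k <_) (sym 1+T≡q[1+k]) (*-monoʳ-< q (n<1+n k)))

noCommonDivisorIn : List ℕ → ℕ → ℕ → Bool
noCommonDivisorIn []      a b = true
noCommonDivisorIn (q ∷ Q) a b = not (does (q ∣? a) ∧ does (q ∣? b)) ∧ noCommonDivisorIn Q a b

sievedPairs : List ℕ → ℕ → ℕ
sievedPairs Q T = sum1to T λ a → sum1to T λ b → 𝟙 (does (a + b ≤? T) ∧ noCommonDivisorIn Q a b)

noCommonDivisorIn-*ˡ : ∀ q R → All (λ r → Coprime r q) R → ∀ a b →
  noCommonDivisorIn R (q * a) (q * b) ≡ noCommonDivisorIn R a b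
noCommonDivisorIn-*ˡ q []      _      a b = refl
noCommonDivisorIn-*ˡ q (r ∷ R) r∷R⊥q a b =
  cong₂ _∧_ (cong₂ (λ u v → not (u ∧ v)) (divides-*ˡ a) (divides-*ˡ b))
            (noCommonDivisorIn-*ˡ q R (All.tail r∷R⊥q) a b)
  where
  r⊥q : Coprime r q
  r⊥q = All.head r∷R⊥q
  divides-*ˡ : ∀ c → does (r ∣? q * c) ≡ does (r ∣? c)
  divides-*ˡ c = does-⇔ (mk⇔ (coprime-divisor r⊥q) (∣n⇒∣m*n q)) (r ∣? q * c) (r ∣? c)

noCommonDivisorIn-true : ∀ Q {a b} → All (λ q → ¬ (q ∣ a × q ∣ b)) Q → noCommonDivisorIn Q a b ≡ true
noCommonDivisorIn-true []      _          = refl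
noCommonDivisorIn-true (q ∷ Q) {a} {b} q∷Q∤ =
  cong₂ _∧_ (cong not (dec-false (q ∣? a ×-dec q ∣? b) (All.head q∷Q∤))) (noCommonDivisorIn-true Q (All.tail q∷Q∤))

𝟙-inclusion-exclusion : ∀ a b c g → 𝟙 (c ∧ (not (a ∧ b) ∧ g)) + 𝟙 a * (𝟙 b * 𝟙 (c ∧ g)) ≡ 𝟙 (c ∧ g)
𝟙-inclusion-exclusion true  true  true  true  = refl
𝟙-inclusion-exclusion true  true  true  false = refl
𝟙-inclusion-exclusion true  true  false g     = refl
𝟙-inclusion-exclusion true  false c     g = +-identityʳ (𝟙 (c ∧ g))
𝟙-inclusion-exclusion false b     c     g = +-identityʳ (𝟙 (c ∧ g))

module _ (q : ℕ) .{{_ : NonZero q}} (R : List ℕ) (R⊥q : All (λ r → Coprime r q) R)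
         (T t : ℕ) (qt≤T : q * t ≤ T) (T<q[1+t] : T < q * suc t) where

  private
    q∣? : ℕ → Bool
    q∣? x = does (q ∣? x)

    counted : ℕ → ℕ → Bool
    counted a b = does (a + b ≤? T) ∧ noCommonDivisorIn R a b

  sievedPairs-multiples :
    sum1to T (λ a → 𝟙 (q∣? a) * sum1to T (λ b → 𝟙 (q∣? b) * 𝟙 (counted a b))) ≡ sievedPairs R t
  sievedPairs-multiples = begin
    sum1to T (λ a → 𝟙 (q∣? a) * sum1to T (λ b → 𝟙 (q∣? b) * 𝟙 (counted a b)))
      ≡⟨ sum1to-multiples q T t qt≤T T<q[1+t] _ ⟩
    sum1to t (λ a → sum1to T (λ b → 𝟙 (q∣? b) * 𝟙 (counted (q * a) b)))
      ≡⟨ sum1to-cong t (λ a _ _ → sum1to-multiples q T t qt≤T T<q[1+t] _) ⟩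
    sum1to t (λ a → sum1to t (λ b → 𝟙 (counted (q * a) (q * b))))
      ≡⟨ sum1to-cong t (λ a _ _ → sum1to-cong t (λ b _ _ → cong 𝟙 (counted-* a b))) ⟩
    sievedPairs R t ∎
    where
    open ≡-Reasoning
    qa+qb≤T⇔a+b≤t : ∀ a b → does (q * a + q * b ≤? T) ≡ does (a + b ≤? t)
    qa+qb≤T⇔a+b≤t a b = does-⇔ (mk⇔
      (λ le → ≤-pred (*-cancelˡ-< q (a + b) (suc t)
                        (≤-<-trans (≤-reflexive (*-distribˡ-+ q a b)) (≤-<-trans le T<q[1+t]))))
      (λ le → ≤-trans (≤-reflexive (sym (*-distribˡ-+ q a b))) (≤-trans (*-monoʳ-≤ q le) qt≤T)))
      (q * a + q * b ≤? T) (a + b ≤? t)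
    counted-* : ∀ a b → counted (q * a) (q * b) ≡ (does (a + b ≤? t) ∧ noCommonDivisorIn R a b)
    counted-* a b = cong₂ _∧_ (qa+qb≤T⇔a+b≤t a b) (noCommonDivisorIn-*ˡ q R R⊥q a b)

  sievedPairs-∷ : sievedPairs (q ∷ R) T + sievedPairs R t ≡ sievedPairs R T
  sievedPairs-∷ = begin
    sievedPairs (q ∷ R) T + sievedPairs R t
      ≡⟨ cong (sievedPairs (q ∷ R) T +_) (sym sievedPairs-multiples) ⟩
    sievedPairs (q ∷ R) T + sum1to T (λ a → 𝟙 (q∣? a) * sum1to T (λ b → 𝟙 (q∣? b) * 𝟙 (counted a b)))
      ≡⟨ cong (sievedPairs (q ∷ R) T +_) (sum1to-cong T (λ a _ _ → sym (sum1to-*ˡ T (𝟙 (q∣? a)) _))) ⟩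
    sievedPairs (q ∷ R) T + sum1to T (λ a → sum1to T (λ b → 𝟙 (q∣? a) * (𝟙 (q∣? b) * 𝟙 (counted a b))))
      ≡⟨ sym (sum1to-distrib-+ T _ _) ⟩
    sum1to T (λ a → sum1to T (λ b → 𝟙 (does (a + b ≤? T) ∧ noCommonDivisorIn (q ∷ R) a b))
                    + sum1to T (λ b → 𝟙 (q∣? a) * (𝟙 (q∣? b) * 𝟙 (counted a b))))
      ≡⟨ sum1to-cong T (λ a _ _ → sym (sum1to-distrib-+ T _ _)) ⟩
    sum1to T (λ a → sum1to T (λ b → 𝟙 (does (a + b ≤? T) ∧ noCommonDivisorIn (q ∷ R) a b)
                                     + 𝟙 (q∣? a) * (𝟙 (q∣? b) * 𝟙 (counted a b))))
      ≡⟨ sum1to-cong T (λ a _ _ → sum1to-cong T (λ b _ _ →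
           𝟙-inclusion-exclusion (q∣? a) (q∣? b) (does (a + b ≤? T)) (noCommonDivisorIn R a b))) ⟩
    sievedPairs R T ∎
    where open ≡-Reasoning

sum1to-𝟙[a+b≤T] : ∀ T a k → sum1to k (λ b → 𝟙 (does (a + b ≤? T) ∧ true)) ≡ k ⊓ (T ∸ a)
sum1to-𝟙[a+b≤T] T a zero    = refl
sum1to-𝟙[a+b≤T] T a (suc k) rewrite sum1to-𝟙[a+b≤T] T a k | ∧-identityʳ (does (a + suc k ≤? T)) with a + suc k ≤? T
... | yes a+1+k≤T = begin
  k ⊓ (T ∸ a) + 𝟙 (does (a + suc k ≤? T)) ≡⟨ cong (k ⊓ (T ∸ a) +_) (𝟙-yes a+1+k≤T (a + suc k ≤? T)) ⟩
  k ⊓ (T ∸ a) + 1 ≡⟨ cong (_+ 1) (m≤n⇒m⊓n≡m (≤-trans (n≤1+n k) 1+k≤T∸a)) ⟩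
  k + 1           ≡⟨ +-comm k 1 ⟩
  suc k           ≡⟨ sym (m≤n⇒m⊓n≡m 1+k≤T∸a) ⟩
  suc k ⊓ (T ∸ a) ∎
  where
  open ≡-Reasoning
  1+k≤T∸a : suc k ≤ T ∸ a
  1+k≤T∸a = subst (_≤ T ∸ a) (m+n∸m≡n a (suc k)) (∸-monoˡ-≤ a a+1+k≤T)
... | no  a+1+k≰T = begin
  k ⊓ (T ∸ a) + 𝟙 (does (a + suc k ≤? T)) ≡⟨ cong (k ⊓ (T ∸ a) +_) (𝟙-no a+1+k≰T (a + suc k ≤? T)) ⟩
  k ⊓ (T ∸ a) + 0 ≡⟨ +-identityʳ _ ⟩
  k ⊓ (T ∸ a)     ≡⟨ m≥n⇒m⊓n≡n T∸a≤k ⟩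
  T ∸ a           ≡⟨ sym (m≥n⇒m⊓n≡n (≤-trans T∸a≤k (n≤1+n k))) ⟩
  suc k ⊓ (T ∸ a) ∎
  where
  open ≡-Reasoning
  T∸a≤k : T ∸ a ≤ k
  T∸a≤k = subst (T ∸ a ≤_) (m+n∸m≡n a k) (∸-monoˡ-≤ a (≤-pred (subst (T <_) (+-suc a k) (≰⇒> a+1+k≰T))))

2*sum1to-id : ∀ k → 2 * sum1to k (λ x → x) ≡ k * suc k
2*sum1to-id zero    = refl
2*sum1to-id (suc k) = begin
  2 * (sum1to k (λ x → x) + suc k)   ≡⟨ *-distribˡ-+ 2 (sum1to k (λ x → x)) (suc k) ⟩
  2 * sum1to k (λ x → x) + 2 * suc k ≡⟨ cong (_+ 2 * suc k) (2*sum1to-id k) ⟩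
  k * suc k + 2 * suc k              ≡⟨ *-distribʳ-+ (suc k) k 2 ⟨
  (k + 2) * suc k                    ≡⟨ *-comm (k + 2) (suc k) ⟩
  suc k * (k + 2)                    ≡⟨ cong (suc k *_) (+-comm k 2) ⟩
  suc k * suc (suc k)                ∎
  where open ≡-Reasoning

sievedPairs-[] : ∀ T → 2 * sievedPairs [] T + T ≡ T * T
sievedPairs-[] T = +-cancelʳ-≡ (2 * S) _ _ (begin
  2 * N + T + 2 * S    ≡⟨ regroup N T S ⟩
  2 * (N + S) + T      ≡⟨ cong (λ z → 2 * z + T) N+S≡T² ⟩
  2 * (T * T) + T      ≡⟨ split-square T ⟩
  T * T + T * suc T    ≡⟨ cong (T * T +_) (2*sum1to-id T) ⟨
  T * T + 2 * S        ∎)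
  where
  open ≡-Reasoning
  N = sievedPairs [] T
  S = sum1to T (λ a → a)
  regroup : ∀ n t s → 2 * n + t + 2 * s ≡ 2 * (n + s) + t
  regroup = solve-∀
  split-square : ∀ t → 2 * (t * t) + t ≡ t * t + t * suc t
  split-square = solve-∀
  N+S≡T² : N + S ≡ T * T
  N+S≡T² = begin
    N + S
      ≡⟨ cong (_+ S) (sum1to-cong T (λ a _ _ → trans (sum1to-𝟙[a+b≤T] T a T) (m≥n⇒m⊓n≡n (m∸n≤m T a)))) ⟩
    sum1to T (λ a → T ∸ a) + S  ≡⟨ sum1to-distrib-+ T _ _ ⟨
    sum1to T (λ a → T ∸ a + a)  ≡⟨ sum1to-cong T (λ a _ a≤T → m∸n+n≡m a≤T) ⟩
    sum1to T (λ _ → T)          ≡⟨ sum1to-const T T ⟩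
    T * T                       ∎

square-≤-floor : ∀ q t T → q * t ≤ T → T < q * suc t → T * T ≤ (q * t) * (q * t) + 2 * q * T
square-≤-floor q t T qt≤T T<q[1+t] = begin
  T * T                               ≤⟨ *-monoʳ-≤ T T≤qt+q ⟩
  T * (q * t + q)                     ≡⟨ solve (q ∷ t ∷ T ∷ []) ⟩
  (q * t) * T + q * T                 ≤⟨ +-monoˡ-≤ (q * T) (*-monoʳ-≤ (q * t) T≤qt+q) ⟩
  (q * t) * (q * t + q) + q * T       ≡⟨ solve (q ∷ t ∷ T ∷ []) ⟩
  (q * t) * (q * t) + q * (q * t) + q * T ≤⟨ +-monoˡ-≤ (q * T) (+-monoʳ-≤ ((q * t) * (q * t)) (*-monoʳ-≤ q qt≤T)) ⟩
  (q * t) * (q * t) + q * T + q * T   ≡⟨ solve (q ∷ t ∷ T ∷ []) ⟩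
  (q * t) * (q * t) + 2 * q * T       ∎
  where
  open ≤-Reasoning
  T≤qt+q : T ≤ q * t + q
  T≤qt+q = <⇒≤ (subst (T <_) (trans (*-suc q t) (+-comm q (q * t))) T<q[1+t])

-- n', nₜ, n stand for N_{q∷R}(T), N_R(t), N_R(T) with t = ⌊T/q⌋, and D, A, B, L for the constants of R.
module _ (q t T D A B L n' nₜ n : ℕ) (qt≤T : q * t ≤ T) (n'+nₜ≡n : n' + nₜ ≡ n) where

  open ≤-Reasoning

  sieve-upper : T < q * suc t → D * n ≤ A * (T * T) + B * T → A * (t * t) ≤ D * nₜ + L * t →
    D * (q * q) * n' + A * (T * T) ≤ A * (q * q) * (T * T) + (2 * A * q + B * (q * q) + L * q) * T
  sieve-upper T<q[1+t] upperT lowerₜ = begin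
    D * (q * q) * n' + A * (T * T)
      ≤⟨ +-monoʳ-≤ (D * (q * q) * n') (*-monoʳ-≤ A (square-≤-floor q t T qt≤T T<q[1+t])) ⟩
    D * (q * q) * n' + A * ((q * t) * (q * t) + 2 * q * T)
      ≡⟨ solve (q ∷ t ∷ T ∷ D ∷ A ∷ n' ∷ []) ⟩
    (q * q) * (D * n' + A * (t * t)) + 2 * A * q * T
      ≤⟨ +-monoˡ-≤ (2 * A * q * T) (*-monoʳ-≤ (q * q) (+-monoʳ-≤ (D * n') lowerₜ)) ⟩
    (q * q) * (D * n' + (D * nₜ + L * t)) + 2 * A * q * T
      ≡⟨ solve (q ∷ t ∷ T ∷ D ∷ A ∷ L ∷ n' ∷ nₜ ∷ []) ⟩
    (q * q) * (D * (n' + nₜ)) + q * L * (q * t) + 2 * A * q * T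
      ≡⟨ cong (λ m → (q * q) * (D * m) + q * L * (q * t) + 2 * A * q * T) n'+nₜ≡n ⟩
    (q * q) * (D * n) + q * L * (q * t) + 2 * A * q * T
      ≤⟨ +-monoˡ-≤ (2 * A * q * T) (+-mono-≤ (*-monoʳ-≤ (q * q) upperT) (*-monoʳ-≤ (q * L) qt≤T)) ⟩
    (q * q) * (A * (T * T) + B * T) + q * L * T + 2 * A * q * T
      ≡⟨ solve (q ∷ T ∷ A ∷ B ∷ L ∷ []) ⟩
    A * (q * q) * (T * T) + (2 * A * q + B * (q * q) + L * q) * T ∎

  sieve-lower : A * (T * T) ≤ D * n + L * T → D * nₜ ≤ A * (t * t) + B * t →
    A * (q * q) * (T * T) ≤ D * (q * q) * n' + (L * (q * q) + B * q) * T + A * (T * T)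
  sieve-lower lowerT upperₜ = begin
    A * (q * q) * (T * T)
      ≡⟨ solve (q ∷ T ∷ A ∷ []) ⟩
    (q * q) * (A * (T * T))
      ≤⟨ *-monoʳ-≤ (q * q) lowerT ⟩
    (q * q) * (D * n + L * T)
      ≡⟨ cong (λ m → (q * q) * (D * m + L * T)) n'+nₜ≡n ⟨
    (q * q) * (D * (n' + nₜ) + L * T)
      ≡⟨ solve (q ∷ T ∷ D ∷ L ∷ n' ∷ nₜ ∷ []) ⟩
    (q * q) * (D * n') + (q * q) * (D * nₜ) + (q * q) * L * T
      ≤⟨ +-monoˡ-≤ ((q * q) * L * T) (+-monoʳ-≤ ((q * q) * (D * n')) (*-monoʳ-≤ (q * q) upperₜ)) ⟩
    (q * q) * (D * n') + (q * q) * (A * (t * t) + B * t) + (q * q) * L * T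
      ≡⟨ solve (q ∷ t ∷ T ∷ D ∷ A ∷ B ∷ L ∷ n' ∷ []) ⟩
    (q * q) * (D * n') + A * ((q * t) * (q * t)) + q * B * (q * t) + (q * q) * L * T
      ≤⟨ +-monoˡ-≤ ((q * q) * L * T) (+-mono-≤ (+-monoʳ-≤ ((q * q) * (D * n')) (*-monoʳ-≤ A (*-mono-≤ qt≤T qt≤T)))
                                               (*-monoʳ-≤ (q * B) qt≤T)) ⟩
    (q * q) * (D * n') + A * (T * T) + q * B * T + (q * q) * L * T
      ≡⟨ solve (q ∷ T ∷ D ∷ A ∷ B ∷ L ∷ n' ∷ []) ⟩
    D * (q * q) * n' + (L * (q * q) + B * q) * T + A * (T * T) ∎

record SieveConstants : Set where
  constructor constants
  field denom lead excess deficit : ℕ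

SieveBounds : List ℕ → SieveConstants → Set
SieveBounds Q c = ∀ T → denom * sievedPairs Q T ≤ lead * (T * T) + excess * T
                      × lead * (T * T) ≤ denom * sievedPairs Q T + deficit * T
  where open SieveConstants c

-- Since N_{q∷R}(T) = N_R(T) − N_R(⌊T/q⌋), each bound for q ∷ R uses both bounds for R.
sieveStep : ℕ → SieveConstants → SieveConstants
sieveStep q (constants D A B L) =
  constants (D * (q * q)) (A * (q * q ∸ 1)) (2 * A * q + B * (q * q) + L * q) (L * (q * q) + B * q)

sieveConstants : List ℕ → SieveConstants
sieveConstants []      = constants 2 1 0 1
sieveConstants (q ∷ Q) = sieveStep q (sieveConstants Q)

sieveBounds-[] : SieveBounds [] (sieveConstants [])
sieveBounds-[] T =
  ≤-trans (m≤m+n (2 * N) T) (≤-reflexive (trans (sievedPairs-[] T) (sym 1*T²+0*T≡T²)))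
  , ≤-reflexive (trans (*-identityˡ (T * T)) (trans (sym (sievedPairs-[] T)) (cong (2 * N +_) (sym (*-identityˡ T)))))
  where
  N = sievedPairs [] T
  1*T²+0*T≡T² : 1 * (T * T) + 0 * T ≡ T * T
  1*T²+0*T≡T² = trans (+-identityʳ _) (*-identityˡ _)

m<n*[1+m/n] : ∀ m n .{{_ : NonZero n}} → m < n * suc (m / n)
m<n*[1+m/n] m n = begin-strict
  m                 ≡⟨ m≡m%n+[m/n]*n m n ⟩
  m % n + m / n * n <⟨ +-monoˡ-< (m / n * n) (m%n<n m n) ⟩
  n + m / n * n     ≡⟨ cong (n +_) (*-comm (m / n) n) ⟩
  n + n * (m / n)   ≡⟨ *-suc n (m / n) ⟨
  n * suc (m / n)   ∎
  where open ≤-Reasoning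

*-pred-square : ∀ A q .{{_ : NonZero q}} x → A * (q * q) * x ≡ A * (q * q ∸ 1) * x + A * x
*-pred-square A q x = begin
  A * (q * q) * x                ≡⟨ cong (λ m → A * m * x) (suc-pred (q * q) {{m*n≢0 q q}}) ⟨
  A * suc (q * q ∸ 1) * x        ≡⟨ cong (_* x) (*-suc A (q * q ∸ 1)) ⟩
  (A + A * (q * q ∸ 1)) * x      ≡⟨ *-distribʳ-+ x A (A * (q * q ∸ 1)) ⟩
  A * x + A * (q * q ∸ 1) * x    ≡⟨ +-comm (A * x) _ ⟩
  A * (q * q ∸ 1) * x + A * x    ∎
  where open ≡-Reasoning

sieveBounds-∷ : ∀ q .{{_ : NonZero q}} R c → All (λ r → Coprime r q) R →
  SieveBounds R c → SieveBounds (q ∷ R) (sieveStep q c)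
sieveBounds-∷ q R (constants D A B L) R⊥q bounds T = upper , lower
  where
  t = T / q
  qt≤T : q * t ≤ T
  qt≤T = subst (_≤ T) (*-comm t q) (m/n*n≤m T q)
  N' = sievedPairs (q ∷ R) T
  n'+nₜ≡n : N' + sievedPairs R t ≡ sievedPairs R T
  n'+nₜ≡n = sievedPairs-∷ q R R⊥q T t qt≤T (m<n*[1+m/n] T q)
  excess' = 2 * A * q + B * (q * q) + L * q
  upper : D * (q * q) * N' ≤ A * (q * q ∸ 1) * (T * T) + excess' * T
  upper = +-cancelʳ-≤ (A * (T * T)) _ _ (begin
    D * (q * q) * N' + A * (T * T)
      ≤⟨ sieve-upper q t T D A B L N' _ _ qt≤T n'+nₜ≡n (m<n*[1+m/n] T q) (proj₁ (bounds T)) (proj₂ (bounds t)) ⟩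
    A * (q * q) * (T * T) + excess' * T
      ≡⟨ cong (_+ excess' * T) (*-pred-square A q (T * T)) ⟩
    A * (q * q ∸ 1) * (T * T) + A * (T * T) + excess' * T
      ≡⟨ xy∙z≈xz∙y (A * (q * q ∸ 1) * (T * T)) (A * (T * T)) (excess' * T) ⟩
    A * (q * q ∸ 1) * (T * T) + excess' * T + A * (T * T) ∎)
    where open ≤-Reasoning
  lower : A * (q * q ∸ 1) * (T * T) ≤ D * (q * q) * N' + (L * (q * q) + B * q) * T
  lower = +-cancelʳ-≤ (A * (T * T)) _ _ (begin
    A * (q * q ∸ 1) * (T * T) + A * (T * T)
      ≡⟨ *-pred-square A q (T * T) ⟨
    A * (q * q) * (T * T)
      ≤⟨ sieve-lower q t T D A B L N' _ _ qt≤T n'+nₜ≡n (proj₂ (bounds T)) (proj₁ (bounds t)) ⟩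
    D * (q * q) * N' + (L * (q * q) + B * q) * T + A * (T * T) ∎)
    where open ≤-Reasoning

sieveBounds : ∀ Q → All NonZero Q → AllPairs Coprime Q → SieveBounds Q (sieveConstants Q)
sieveBounds []      _        _          = sieveBounds-[]
sieveBounds (q ∷ Q) q∷Q≢0 q∷Q-coprime =
  sieveBounds-∷ q {{All.head q∷Q≢0}} Q (sieveConstants Q)
    (All.map Coprime.sym (AllPairs.head q∷Q-coprime))
    (sieveBounds Q (All.tail q∷Q≢0) (AllPairs.tail q∷Q-coprime))

rescale-≤ : ∀ D A B k a b n x y .{{_ : NonZero D}} → D * n ≤ A * x + B * y →
  k * A ≤ a * D → k * B ≤ b * D → k * n ≤ a * x + b * y
rescale-≤ D A B k a b n x y Dn≤Ax+By kA≤aD kB≤bD = *-cancelˡ-≤ D (begin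
  D * (k * n)             ≡⟨ solve (D ∷ k ∷ n ∷ []) ⟩
  k * (D * n)             ≤⟨ *-monoʳ-≤ k Dn≤Ax+By ⟩
  k * (A * x + B * y)     ≡⟨ solve (k ∷ A ∷ B ∷ x ∷ y ∷ []) ⟩
  k * A * x + k * B * y   ≤⟨ +-mono-≤ (*-monoˡ-≤ x kA≤aD) (*-monoˡ-≤ y kB≤bD) ⟩
  a * D * x + b * D * y   ≡⟨ solve (D ∷ a ∷ b ∷ x ∷ y ∷ []) ⟩
  D * (a * x + b * y)     ∎)
  where open ≤-Reasoning

-- sieveConstants is a right fold, so 2 is sieved first; this order keeps excess below 2.13 · denom.
smallPrimes : List ℕ
smallPrimes = 17 ∷ 13 ∷ 11 ∷ 7 ∷ 5 ∷ 3 ∷ 2 ∷ []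

sievedPairs-smallPrimes : ∀ T → 1000 * sievedPairs smallPrimes T ≤ 308 * (T * T) + 2130 * T
sievedPairs-smallPrimes T =
  rescale-≤ denom lead excess 1000 308 2130 (sievedPairs smallPrimes T) (T * T) T
    (proj₁ (bounds T)) (from-yes (1000 * lead ≤? 308 * denom)) (from-yes (1000 * excess ≤? 2130 * denom))
  where
  open SieveConstants (sieveConstants smallPrimes)
  bounds : SieveBounds smallPrimes (sieveConstants smallPrimes)
  bounds = sieveBounds smallPrimes (from-yes (all? nonZero? smallPrimes)) (from-yes (allPairs? coprime? smallPrimes))

linearForm-pos : ∀ i x y →
  ℤ.+ i ℤ.* ℤ.+ x ℤ.+ ℤ.+ (i + 1) ℤ.* ℤ.+ y ℤ.- ℤ.+ 0 ≡ ℤ.+ (i * x + (i + 1) * y + 0)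
linearForm-pos i x y rewrite sym (ℤ.pos-* i x) | sym (ℤ.pos-* (i + 1) y) = refl

linearForm≡0⇔∣ : ∀ p i x y →
  (ℤ.+ i ℤ.* ℤ.+ x ℤ.+ ℤ.+ (i + 1) ℤ.* ℤ.+ y) ≡ ℤ.+ 0 [mod p ] ⇔ p ∣ i * x + (i + 1) * y
linearForm≡0⇔∣ p i x y = mk⇔
  (λ ≡0 → subst (p ∣_) (+-identityʳ _) (subst (λ z → p ∣ ℤ.∣ z ∣) (linearForm-pos i x y) ≡0))
  (λ p∣ → subst (λ z → p ∣ ℤ.∣ z ∣) (sym (linearForm-pos i x y)) (subst (p ∣_) (sym (+-identityʳ _)) p∣))

prime∣small*n⇒∣n : ∀ {p q n} → Prime p → 1 ≤ q → q < p → p ∣ q * n → p ∣ n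
prime∣small*n⇒∣n {p} {q} {n} pp 1≤q q<p p∣qn with euclidsLemma q n pp p∣qn
... | inj₁ p∣q = contradiction p∣q (>⇒∤ {{>-nonZero 1≤q}} q<p)
... | inj₂ p∣n = p∣n

minPair-noCommonDivisor : ∀ {p} i {xm ym x y} → Prime p → IsMinPair p i xm ym x y →
  ∀ {q} → 2 ≤ q → q < p → q ∣ x → q ∣ y → ⊥
minPair-noCommonDivisor {p} i {xm} {ym} pp ((1≤x , x≤xm , 1≤y , y≤ym , ≡0) , minimal) {q} 2≤q q<p
                        (divides x' refl) (divides y' refl) =
  contradiction (minimal x' y' admissible) (<⇒≱ smaller)
  where
  instance
    q≢0 : NonZero q
    q≢0 = >-nonZero (<-trans z<s 2≤q)
  factor-pos : ∀ {m} → 1 ≤ m * q → 1 ≤ m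
  factor-pos {suc m} _ = s≤s z≤n
  scaled : i * (x' * q) + (i + 1) * (y' * q) ≡ q * (i * x' + (i + 1) * y')
  scaled = solve (i ∷ x' ∷ y' ∷ q ∷ [])
  admissible : Admissible p i xm ym x' y'
  admissible = factor-pos 1≤x , ≤-trans (m≤m*n x' q) x≤xm , factor-pos 1≤y , ≤-trans (m≤m*n y' q) y≤ym ,
    Equivalence.from (linearForm≡0⇔∣ p i x' y')
      (prime∣small*n⇒∣n pp (<-trans z<s 2≤q) q<p
        (subst (p ∣_) scaled (Equivalence.to (linearForm≡0⇔∣ p i (x' * q) (y' * q)) ≡0)))
  smaller : x' + y' < x' * q + y' * q
  smaller = subst (x' + y' <_) (*-distribʳ-+ q x' y')
              (m<m*n (x' + y') q {{>-nonZero (≤-trans (factor-pos 1≤x) (m≤m+n x' y'))}} 2≤q)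

∣x+y⇒x+y≡p : ∀ {p x y} → p ∣ x + y → 1 ≤ x → x < p → y < p → x + y ≡ p
∣x+y⇒x+y≡p {p} {x} {y} (divides zero          x+y≡0)      1≤x _   _   =
  contradiction (subst (1 ≤_) x+y≡0 (≤-trans 1≤x (m≤m+n x y))) λ ()
∣x+y⇒x+y≡p {p} {x} {y} (divides (suc zero)    x+y≡p+0)    _   _   _   = trans x+y≡p+0 (+-identityʳ p)
∣x+y⇒x+y≡p {p} {x} {y} (divides (suc (suc m)) x+y≡[2+m]p) _   x<p y<p =
  contradiction (subst (p + p ≤_) (sym x+y≡[2+m]p) (+-monoʳ-≤ p (m≤m+n p (m * p)))) (<⇒≱ (+-mono-< x<p y<p))

linearRelations-unique : ∀ {p i j x y} → Prime p → 1 ≤ x → x < p → 1 ≤ y → y < p → i < j → j < p →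
  p ∣ i * x + (i + 1) * y → p ∣ j * x + (j + 1) * y → ⊥
linearRelations-unique {p} {i} {j} {x} {y} pp 1≤x x<p 1≤y y<p i<j j<p p∣relᵢ p∣relⱼ =
  contradiction p∣y (>⇒∤ {{>-nonZero 1≤y}} y<p)
  where
  k = j ∸ i
  expand : ∀ i k x y → (i + k) * x + (i + k + 1) * y ≡ (i * x + (i + 1) * y) + k * (x + y)
  expand = solve-∀
  regroup : ∀ i x y → i * x + (i + 1) * y ≡ i * (x + y) + y
  regroup = solve-∀
  p∣k[x+y] : p ∣ k * (x + y)
  p∣k[x+y] = ∣m+n∣m⇒∣n
    (subst (p ∣_) (expand i k x y) (subst (λ j → p ∣ j * x + (j + 1) * y) (sym (m+[n∸m]≡n (<⇒≤ i<j))) p∣relⱼ))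
    p∣relᵢ
  x+y≡p : x + y ≡ p
  x+y≡p = ∣x+y⇒x+y≡p (prime∣small*n⇒∣n pp (m<n⇒0<n∸m i<j) (≤-<-trans (m∸n≤m j i) j<p) p∣k[x+y]) 1≤x x<p y<p
  p∣y : p ∣ y
  p∣y = ∣m+n∣m⇒∣n (subst (p ∣_) (trans (regroup i x y) (cong (λ s → i * s + y) x+y≡p)) p∣relᵢ) (n∣m*n i)

≤∸1⇒< : ∀ {m n} → 1 ≤ m → m ≤ n ∸ 1 → m < n
≤∸1⇒< {n = zero}  1≤m m≤0 = contradiction (≤-trans 1≤m m≤0) λ ()
≤∸1⇒< {n = suc n} _   m≤n = s≤s m≤n

minPair-residues : ∀ p i {xm ym x y} → IsXMax p i xm → IsYMax p i ym → IsMinPair p i xm ym x y →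
  (1 ≤ x × x < p) × (1 ≤ y × y < p)
minPair-residues p i (_ , xm≤p-1 , _) (_ , ym≤p-1 , _) ((1≤x , x≤xm , 1≤y , y≤ym , _) , _) =
  (1≤x , ≤∸1⇒< 1≤x (≤-trans x≤xm xm≤p-1)) , (1≤y , ≤∸1⇒< 1≤y (≤-trans y≤ym ym≤p-1))

minPair-relation : ∀ p i {xm ym x y} → IsMinPair p i xm ym x y → p ∣ i * x + (i + 1) * y
minPair-relation p i {x = x} {y} ((_ , _ , _ , _ , ≡0) , _) = Equivalence.to (linearForm≡0⇔∣ p i x y) ≡0

module MinimalPairs (p : ℕ) (pp : Prime p) (xm ym x y : ℕ → ℕ)
  (isXMax : ∀ i → 1 ≤ i → i ≤ p ∸ 2 → IsXMax p i (xm i))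
  (isYMax : ∀ i → 1 ≤ i → i ≤ p ∸ 2 → IsYMax p i (ym i))
  (isMinPair : ∀ i → 1 ≤ i → i ≤ p ∸ 2 → IsMinPair p i (xm i) (ym i) (x i) (y i)) where

  residues : ∀ i → 1 ≤ i → i ≤ p ∸ 2 → (1 ≤ x i × x i < p) × (1 ≤ y i × y i < p)
  residues i 1≤i i≤n = minPair-residues p i (isXMax i 1≤i i≤n) (isYMax i 1≤i i≤n) (isMinPair i 1≤i i≤n)

  1≤x : ∀ i → 1 ≤ i → i ≤ p ∸ 2 → 1 ≤ x i
  1≤x i 1≤i i≤n = proj₁ (proj₁ (residues i 1≤i i≤n))

  1≤y : ∀ i → 1 ≤ i → i ≤ p ∸ 2 → 1 ≤ y i
  1≤y i 1≤i i≤n = proj₁ (proj₂ (residues i 1≤i i≤n))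

  x<p : ∀ i → 1 ≤ i → i ≤ p ∸ 2 → x i < p
  x<p i 1≤i i≤n = proj₂ (proj₁ (residues i 1≤i i≤n))

  y<p : ∀ i → 1 ≤ i → i ≤ p ∸ 2 → y i < p
  y<p i 1≤i i≤n = proj₂ (proj₂ (residues i 1≤i i≤n))

  smallPrimes-sieved : 17 < p → ∀ i → 1 ≤ i → i ≤ p ∸ 2 → noCommonDivisorIn smallPrimes (x i) (y i) ≡ true
  smallPrimes-sieved 17<p i 1≤i i≤n = noCommonDivisorIn-true smallPrimes (All.map
    (λ (2≤q , q≤17) (q∣x , q∣y) → minPair-noCommonDivisor i pp (isMinPair i 1≤i i≤n) 2≤q (≤-<-trans q≤17 17<p) q∣x q∣y)
    (from-yes (all? (λ q → 2 ≤? q ×-dec q ≤? 17) smallPrimes)))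

  distinct : ∀ i j → 1 ≤ i → i < j → j ≤ p ∸ 2 → x i ≡ x j → y i ≡ y j → ⊥
  distinct i j 1≤i i<j j≤n xᵢ≡xⱼ yᵢ≡yⱼ =
    linearRelations-unique pp (1≤x j 1≤j j≤n) (x<p j 1≤j j≤n) (1≤y j 1≤j j≤n) (y<p j 1≤j j≤n) i<j j<p
      (subst₂ (λ u v → p ∣ i * u + (i + 1) * v) xᵢ≡xⱼ yᵢ≡yⱼ (minPair-relation p i (isMinPair i 1≤i i≤n)))
      (minPair-relation p j (isMinPair j 1≤j j≤n))
    where
    1≤j = ≤-trans 1≤i (<⇒≤ i<j)
    i≤n = ≤-trans (<⇒≤ i<j) j≤n
    j<p = ≤∸1⇒< 1≤j (≤-trans j≤n (∸-monoʳ-≤ p (s≤s z≤n)))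

module _ (Q : List ℕ) (n : ℕ) (x y : ℕ → ℕ)
         (1≤x : ∀ i → 1 ≤ i → i ≤ n → 1 ≤ x i)
         (1≤y : ∀ i → 1 ≤ i → i ≤ n → 1 ≤ y i)
         (sieved : ∀ i → 1 ≤ i → i ≤ n → noCommonDivisorIn Q (x i) (y i) ≡ true)
         (distinct : ∀ i j → 1 ≤ i → i < j → j ≤ n → x i ≡ x j → y i ≡ y j → ⊥) where

  count≤sievedPairs : ∀ T → sum1to n (λ i → 𝟙 (does (x i + y i ≤? T))) ≤ sievedPairs Q T
  count≤sievedPairs T = begin
    sum1to n (λ i → 𝟙 (does (x i + y i ≤? T)))
      ≤⟨ sum1to-mono-≤ n point≤pairs ⟩
    sum1to n (λ i → sum1to T (λ a → sum1to T (λ b → 𝟙 (does (at i a b)) * G a b)))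
      ≡⟨ sum1to-comm n T _ ⟩
    sum1to T (λ a → sum1to n (λ i → sum1to T (λ b → 𝟙 (does (at i a b)) * G a b)))
      ≡⟨ sum1to-cong T (λ a _ _ → sum1to-comm n T _) ⟩
    sum1to T (λ a → sum1to T (λ b → sum1to n (λ i → 𝟙 (does (at i a b)) * G a b)))
      ≡⟨ sum1to-cong T (λ a _ _ → sum1to-cong T (λ b _ _ → sum1to-*ʳ n (G a b) _)) ⟩
    sum1to T (λ a → sum1to T (λ b → sum1to n (λ i → 𝟙 (does (at i a b))) * G a b))
      ≤⟨ sum1to-mono-≤ T (λ a _ _ → sum1to-mono-≤ T (λ b _ _ → *-monoˡ-≤ (G a b) (at-most-once a b))) ⟩
    sum1to T (λ a → sum1to T (λ b → 1 * G a b))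
      ≡⟨ sum1to-cong T (λ a _ _ → sum1to-cong T (λ b _ _ → *-identityˡ (G a b))) ⟩
    sievedPairs Q T ∎
    where
    open ≤-Reasoning
    G : ℕ → ℕ → ℕ
    G a b = 𝟙 (does (a + b ≤? T) ∧ noCommonDivisorIn Q a b)
    at : ∀ i a b → Dec (x i ≡ a × y i ≡ b)
    at i a b = x i ≟ a ×-dec y i ≟ b
    at-most-once : ∀ a b → sum1to n (λ i → 𝟙 (does (at i a b))) ≤ 1
    at-most-once a b = sum1to-𝟙≤1 n (λ i → at i a b)
      λ { i j 1≤i i<j j≤n (xᵢ≡a , yᵢ≡b) (xⱼ≡a , yⱼ≡b) →
            distinct i j 1≤i i<j j≤n (trans xᵢ≡a (sym xⱼ≡a)) (trans yᵢ≡b (sym yⱼ≡b)) }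
    point≤pairs : ∀ i → 1 ≤ i → i ≤ n →
      𝟙 (does (x i + y i ≤? T)) ≤ sum1to T (λ a → sum1to T (λ b → 𝟙 (does (at i a b)) * G a b))
    point≤pairs i 1≤i i≤n with x i + y i ≤? T
    ... | no  xᵢ+yᵢ≰T = ≤-trans (≤-reflexive (𝟙-no xᵢ+yᵢ≰T (x i + y i ≤? T))) z≤n
    ... | yes xᵢ+yᵢ≤T = begin
      𝟙 (does (x i + y i ≤? T))
        ≡⟨ 𝟙-yes xᵢ+yᵢ≤T (x i + y i ≤? T) ⟩
      1
        ≡⟨ cong₂ (λ u v → 𝟙 u * 𝟙 v) (dec-true (at i (x i) (y i)) (refl , refl)) counted ⟨
      𝟙 (does (at i (x i) (y i))) * G (x i) (y i)
        ≤⟨ term≤sum1to T _ (y i) (1≤y i 1≤i i≤n) (≤-trans (m≤n+m (y i) (x i)) xᵢ+yᵢ≤T) ⟩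
      sum1to T (λ b → 𝟙 (does (at i (x i) b)) * G (x i) b)
        ≤⟨ term≤sum1to T _ (x i) (1≤x i 1≤i i≤n) (≤-trans (m≤m+n (x i) (y i)) xᵢ+yᵢ≤T) ⟩
      sum1to T (λ a → sum1to T (λ b → 𝟙 (does (at i a b)) * G a b)) ∎
      where
      counted : (does (x i + y i ≤? T) ∧ noCommonDivisorIn Q (x i) (y i)) ≡ true
      counted = trans (cong (_∧ _) (dec-true (x i + y i ≤? T) xᵢ+yᵢ≤T)) (sieved i 1≤i i≤n)

-- sum1to starts at k = 1, so level k tests s ≤ k − 1, and M ∸ s levels pass.
value+levels-≥ : ∀ M s → M ≤ s + sum1to M (λ k → 𝟙 (does (s ≤? pred k)))
value+levels-≥ zero    s = z≤n
value+levels-≥ (suc M) s with s ≤? M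
... | no  s≰M = ≤-trans (≰⇒> s≰M) (m≤m+n s _)
... | yes s≤M = begin
  suc M                          ≤⟨ s≤s (value+levels-≥ M s) ⟩
  suc (s + L)                    ≡⟨ +-suc s L ⟨
  s + suc L                      ≡⟨ cong (s +_) (+-comm 1 L) ⟩
  s + (L + 1)                    ≡⟨ cong (λ z → s + (L + z)) (𝟙-yes s≤M (s ≤? M)) ⟨
  s + (L + 𝟙 (does (s ≤? M)))    ∎
  where
  open ≤-Reasoning
  L = sum1to M (λ k → 𝟙 (does (s ≤? pred k)))

layer-cake : ∀ n M (s : ℕ → ℕ) →
  n * M ≤ sum1to n s + sum1to M (λ k → sum1to n (λ i → 𝟙 (does (s i ≤? pred k))))
layer-cake n M s = begin
  n * M                                                            ≡⟨ sum1to-const n M ⟨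
  sum1to n (λ _ → M)                                               ≤⟨ sum1to-mono-≤ n (λ i _ _ → value+levels-≥ M (s i)) ⟩
  sum1to n (λ i → s i + sum1to M (λ k → 𝟙 (does (s i ≤? pred k)))) ≡⟨ sum1to-distrib-+ n _ _ ⟩
  sum1to n s + sum1to n (λ i → sum1to M (λ k → 𝟙 (does (s i ≤? pred k))))
                                                                   ≡⟨ cong (sum1to n s +_) (sum1to-comm n M _) ⟩
  sum1to n s + sum1to M (λ k → sum1to n (λ i → 𝟙 (does (s i ≤? pred k)))) ∎
  where open ≤-Reasoning

sum1to-pred²-≤ : ∀ M → 3 * sum1to M (λ k → pred k * pred k) ≤ M * M * M
sum1to-pred²-≤ zero    = z≤n
sum1to-pred²-≤ (suc M) = begin
  3 * (S + M * M)                      ≡⟨ *-distribˡ-+ 3 S (M * M) ⟩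
  3 * S + 3 * (M * M)                  ≤⟨ +-monoˡ-≤ (3 * (M * M)) (sum1to-pred²-≤ M) ⟩
  M * M * M + 3 * (M * M)              ≤⟨ m≤m+n _ (3 * M + 1) ⟩
  M * M * M + 3 * (M * M) + (3 * M + 1) ≡⟨ solve (M ∷ []) ⟩
  suc M * suc M * suc M                ∎
  where
  open ≤-Reasoning
  S = sum1to M (λ k → pred k * pred k)

sum1to-pred-≤ : ∀ M → 2 * sum1to M pred ≤ M * M
sum1to-pred-≤ zero    = z≤n
sum1to-pred-≤ (suc M) = begin
  2 * (S + M)              ≡⟨ *-distribˡ-+ 2 S M ⟩
  2 * S + 2 * M            ≤⟨ +-monoˡ-≤ (2 * M) (sum1to-pred-≤ M) ⟩
  M * M + 2 * M            ≤⟨ m≤m+n _ 1 ⟩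
  M * M + 2 * M + 1        ≡⟨ solve (M ∷ []) ⟩
  suc M * suc M            ∎
  where
  open ≤-Reasoning
  S = sum1to M pred

sum1to-≥-from-counts : ∀ n (s : ℕ → ℕ) →
  (∀ T → 1000 * sum1to n (λ i → 𝟙 (does (s i ≤? T))) ≤ 308 * (T * T) + 2130 * T) →
  ∀ M → 6000 * (n * M) ≤ 6000 * sum1to n s + 616 * (M * M * M) + 6390 * (M * M)
sum1to-≥-from-counts n s counts M = begin
  6000 * (n * M)                         ≤⟨ *-monoʳ-≤ 6000 (layer-cake n M s) ⟩
  6000 * (c + levels)                    ≡⟨ split-6000 c levels ⟩
  6000 * c + 6 * (1000 * levels)         ≤⟨ +-monoʳ-≤ (6000 * c) (*-monoʳ-≤ 6 levels-bound) ⟩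
  6000 * c + 6 * (308 * S₂ + 2130 * S₁)  ≡⟨ rescale c S₂ S₁ ⟩
  6000 * c + 616 * (3 * S₂) + 6390 * (2 * S₁)
                                         ≤⟨ +-mono-≤ (+-monoʳ-≤ (6000 * c) (*-monoʳ-≤ 616 (sum1to-pred²-≤ M)))
                                                     (*-monoʳ-≤ 6390 (sum1to-pred-≤ M)) ⟩
  6000 * c + 616 * (M * M * M) + 6390 * (M * M) ∎
  where
  open ≤-Reasoning
  c = sum1to n s
  levels = sum1to M (λ k → sum1to n (λ i → 𝟙 (does (s i ≤? pred k))))
  S₂ = sum1to M (λ k → pred k * pred k)
  S₁ = sum1to M pred
  split-6000 : ∀ c l → 6000 * (c + l) ≡ 6000 * c + 6 * (1000 * l)
  split-6000 = solve-∀
  rescale : ∀ c s₂ s₁ → 6000 * c + 6 * (308 * s₂ + 2130 * s₁) ≡ 6000 * c + 616 * (3 * s₂) + 6390 * (2 * s₁)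
  rescale = solve-∀
  levels-bound : 1000 * levels ≤ 308 * S₂ + 2130 * S₁
  levels-bound = begin
    1000 * levels                                      ≡⟨ sum1to-*ˡ M 1000 _ ⟨
    sum1to M (λ k → 1000 * sum1to n (λ i → 𝟙 (does (s i ≤? pred k))))
                                                       ≤⟨ sum1to-mono-≤ M (λ k _ _ → counts (pred k)) ⟩
    sum1to M (λ k → 308 * (pred k * pred k) + 2130 * pred k)
                                                       ≡⟨ sum1to-distrib-+ M _ _ ⟩
    sum1to M (λ k → 308 * (pred k * pred k)) + sum1to M (λ k → 2130 * pred k)
                                                       ≡⟨ cong₂ _+_ (sum1to-*ˡ M 308 _) (sum1to-*ˡ M 2130 pred) ⟩
    308 * S₂ + 2130 * S₁                               ∎

isqrt : ∀ k .{{_ : NonZero k}} N → ∃ λ M → k * (M * M) ≤ N × N < k * (suc M * suc M)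
isqrt k zero    = 0 , ≤-reflexive (*-zeroʳ k) , subst (0 <_) (sym (*-identityʳ k)) (>-nonZero⁻¹ k)
isqrt k (suc N) with isqrt k N
... | M , kM²≤N , N<k[1+M]² with suc N <? k * (suc M * suc M)
...   | yes 1+N<k[1+M]² = M , m≤n⇒m≤1+n kM²≤N , 1+N<k[1+M]²
...   | no  1+N≮k[1+M]² = suc M , ≤-reflexive (sym 1+N≡k[1+M]²) ,
                          subst (_< k * (suc (suc M) * suc (suc M))) (sym 1+N≡k[1+M]²)
                                (*-monoʳ-< k (*-mono-< (n<1+n (suc M)) (n<1+n (suc M))))
  where
  1+N≡k[1+M]² : suc N ≡ k * (suc M * suc M)
  1+N≡k[1+M]² = ≤-antisym N<k[1+M]² (≮⇒≥ 1+N≮k[1+M]²)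

linear-bound : ∀ c p x u w M → 25 * w ≤ 81 * x → 25 * u ≤ 81 * p → 300000 * M ≤ 104 * x →
  6000 * x ≤ 6000 * c + 616 * w + 6390 * u + 12000 * M →
  10 * x ≤ 15 * c + 52 * p
linear-bound c p x u w M 25w≤81x 25u≤81p 300000M≤104x 6000x≤ = *-cancelˡ-≤ 10000 (begin
  10000 * (10 * x)          ≡⟨ solve (x ∷ []) ⟩
  100000 * x                ≤⟨ +-cancelʳ-≤ (50000 * x) _ _ scaled ⟩
  150000 * c + 517590 * p   ≤⟨ +-monoʳ-≤ (150000 * c) (*-monoˡ-≤ p (m≤m+n 517590 2410)) ⟩
  150000 * c + 520000 * p   ≡⟨ solve (c ∷ p ∷ []) ⟩
  10000 * (15 * c + 52 * p) ∎)
  where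
  open ≤-Reasoning
  scaled : 100000 * x + 50000 * x ≤ 150000 * c + 517590 * p + 50000 * x
  scaled = begin
    100000 * x + 50000 * x
      ≡⟨ solve (x ∷ []) ⟩
    25 * (6000 * x)
      ≤⟨ *-monoʳ-≤ 25 6000x≤ ⟩
    25 * (6000 * c + 616 * w + 6390 * u + 12000 * M)
      ≡⟨ solve (c ∷ w ∷ u ∷ M ∷ []) ⟩
    150000 * c + 616 * (25 * w) + 6390 * (25 * u) + 300000 * M
      ≤⟨ +-mono-≤ (+-mono-≤ (+-monoʳ-≤ (150000 * c) (*-monoʳ-≤ 616 25w≤81x)) (*-monoʳ-≤ 6390 25u≤81p)) 300000M≤104x ⟩
    150000 * c + 616 * (81 * x) + 6390 * (81 * p) + 104 * x
      ≡⟨ solve (c ∷ p ∷ x ∷ []) ⟩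
    150000 * c + 517590 * p + 50000 * x ∎

p³-bound : ∀ p M Y .{{_ : NonZero p}} → 81 * p < 25 * (suc M * suc M) → 10 * p * suc M < 3 * Y →
  36 * p ^ 3 < Y ^ 2
p³-bound p M Y 81p<25[1+M]² 10p[1+M]<3Y = *-cancelˡ-< 225 _ _ (begin-strict
  225 * (36 * (p * (p * (p * 1))))     ≡⟨ solve (p ∷ []) ⟩
  100 * (p * p) * (81 * p)              <⟨ *-monoʳ-< (100 * (p * p)) {{100p²≢0}} 81p<25[1+M]² ⟩
  100 * (p * p) * (25 * (suc M * suc M)) ≡⟨ solve (p ∷ M ∷ []) ⟩
  25 * ((10 * p * suc M) * (10 * p * suc M)) <⟨ *-monoʳ-< 25 (*-mono-< 10p[1+M]<3Y 10p[1+M]<3Y) ⟩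
  25 * ((3 * Y) * (3 * Y))              ≡⟨ solve (Y ∷ []) ⟩
  225 * (Y * (Y * 1))                   ∎)
  where
  open ≤-Reasoning
  100p²≢0 : NonZero (100 * (p * p))
  100p²≢0 = m*n≢0 100 (p * p) {{_}} {{m*n≢0 p p}}

-- M = ⌊9√p/5⌋ ≈ √(p/0.308) balances the two terms of the layer-cake bound.
cubic-bound : ∀ p c → 10 ^ 6 < p →
  (∀ M → 6000 * ((p ∸ 2) * M) ≤ 6000 * c + 616 * (M * M * M) + 6390 * (M * M)) →
  36 * p ^ 3 < (5 * c + 80 * p) ^ 2
cubic-bound p c 10⁶<p partial-sums with isqrt 25 (81 * p)
... | M , 25M²≤81p , 81p<25[1+M]² = p³-bound p M (5 * c + 80 * p) 81p<25[1+M]² 10p[1+M]<3Y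
  where
  instance
    p≢0 : NonZero p
    p≢0 = >-nonZero (<-trans z<s 10⁶<p)
  p-large : 300000 ≤ 104 * p
  p-large = ≤-trans (m≤m+n 300000 103700000) (*-monoʳ-≤ 104 (<⇒≤ 10⁶<p))
  shift : ∀ q M → 6000 * ((q + 2) * M) ≡ 6000 * (q * M) + 12000 * M
  shift q M = solve (q ∷ M ∷ [])
  sum-bound : 6000 * (p * M) ≤ 6000 * c + 616 * (M * M * M) + 6390 * (M * M) + 12000 * M
  sum-bound = begin
    6000 * (p * M)                   ≡⟨ cong (λ n → 6000 * (n * M)) (m∸n+n≡m (≤-trans (m≤m+n 2 999998) (<⇒≤ 10⁶<p))) ⟨
    6000 * ((p ∸ 2 + 2) * M)         ≡⟨ shift (p ∸ 2) M ⟩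
    6000 * ((p ∸ 2) * M) + 12000 * M ≤⟨ +-monoˡ-≤ (12000 * M) (partial-sums M) ⟩
    6000 * c + 616 * (M * M * M) + 6390 * (M * M) + 12000 * M ∎
    where open ≤-Reasoning
  25M³≤81pM : 25 * (M * M * M) ≤ 81 * (p * M)
  25M³≤81pM = begin
    25 * (M * M * M)   ≡⟨ solve (M ∷ []) ⟩
    M * (25 * (M * M)) ≤⟨ *-monoʳ-≤ M 25M²≤81p ⟩
    M * (81 * p)       ≡⟨ solve (p ∷ M ∷ []) ⟩
    81 * (p * M)       ∎
    where open ≤-Reasoning
  300000M≤104pM : 300000 * M ≤ 104 * (p * M)
  300000M≤104pM = ≤-trans (*-monoˡ-≤ M p-large) (≤-reflexive (*-assoc 104 p M))
  10p[1+M]<3Y : 10 * p * suc M < 3 * (5 * c + 80 * p)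
  10p[1+M]<3Y = begin-strict
    10 * p * suc M             ≡⟨ solve (p ∷ M ∷ []) ⟩
    10 * p + 10 * (p * M)      ≤⟨ +-monoʳ-≤ (10 * p) (linear-bound c p (p * M) (M * M) (M * M * M) M
                                                        25M³≤81pM 25M²≤81p 300000M≤104pM sum-bound) ⟩
    10 * p + (15 * c + 52 * p) ≡⟨ solve (c ∷ p ∷ []) ⟩
    15 * c + 62 * p            <⟨ +-monoʳ-< (15 * c) (*-monoˡ-< p (m<n+m 62 {178} z<s)) ⟩
    15 * c + 240 * p           ≡⟨ solve (c ∷ p ∷ []) ⟩
    3 * (5 * c + 80 * p)       ∎
    where open ≤-Reasoning

lemma2p11 : (p : ℕ) → Prime p → 10 ^ 6 < p →
    (xm ym x y : ℕ → ℕ) →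
    (∀ i → 1 ≤ i → i ≤ p ∸ 2 → IsXMax p i (xm i)) →
    (∀ i → 1 ≤ i → i ≤ p ∸ 2 → IsYMax p i (ym i)) →
    (∀ i → 1 ≤ i → i ≤ p ∸ 2 → IsMinPair p i (xm i) (ym i) (x i) (y i)) →
    36 * p ^ 3 < (5 * sum1to (p ∸ 2) (λ i → x i + y i) + 80 * p) ^ 2
lemma2p11 p pp 10⁶<p xm ym x y isXMax isYMax isMinPair =
  cubic-bound p (sum1to (p ∸ 2) s) 10⁶<p (sum1to-≥-from-counts (p ∸ 2) s counts)
  where
  open MinimalPairs p pp xm ym x y isXMax isYMax isMinPair
  s : ℕ → ℕ
  s i = x i + y i
  counts : ∀ T → 1000 * sum1to (p ∸ 2) (λ i → 𝟙 (does (s i ≤? T))) ≤ 308 * (T * T) + 2130 * T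
  counts T = ≤-trans
    (*-monoʳ-≤ 1000 (count≤sievedPairs smallPrimes (p ∸ 2) x y 1≤x 1≤y
      (smallPrimes-sieved (≤-<-trans (m≤m+n 17 999983) 10⁶<p)) distinct T))
    (sievedPairs-smallPrimes T)
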